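{- Let $S$ be as in the context. The subgroup $\mathbf W_P$ of $\mathrm{GL}_n(F_2)$ generated by $\mathbf{s_1},\dots,\mathbf{s_{n-1}}$ is isomorphic to the symmetric group $S_n$ on the $n$-element set $\Pi$.
   Context: $S$ is a finite simple connected graph with vertex set $\{s_1,\dots,s_n\}$, $n\ge2$, and edge set $R$, such that $s_1,\dots,s_{n-1}$ is an induced path; $s_n$ is adjacent to some of $s_1,\dots,s_{n-1}$. $\widetilde s$ is the characteristic vector in $F_2^n$ (coordinates indexed by vertices) of vertex $s$. The flipping move of $s$ is $\mathbf s\in\mathrm{Mat}_n(F_2)$ with $\mathbf s_{ab}=1$ if $a=b$, or if $b=s$ and $ab\in R$, and $0$ otherwise. $\overline1=\widetilde s_1$, $\overline{i+1}=\mathbf{s_i}\cdots\mathbf{s_1}\overline1$ for $1\le i\le n-1$, and $\Pi=\{\overline1,\dots,\overline n\}$. -}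

module Defs where

open import Data.Nat using (ℕ; zero; suc)
open import Data.Bool using (Bool; true; false; _∧_; _∨_; _xor_; if_then_else_)
open import Data.Fin using (Fin; zero; suc; toℕ; inject₁; _≟_)
open import Data.Product using (Σ; _,_; proj₁; ∃)
open import Data.Sum using (_⊎_)
open import Relation.Nullary.Decidable using (⌊_⌋)
open import Relation.Binary.PropositionalEquality using (_≡_)
open import Data.Fin.Permutation using (Permutation′; _⟨$⟩ʳ_)

-- F₂ is modelled by Bool: addition = _xor_, multiplication = _∧_.
F₂ : Set
F₂ = Bool

Vec₂ : ℕ → Set
Vec₂ n = Fin n → F₂

Mat : ℕ → Set
Mat n = Fin n → Fin n → F₂

sum₂ : ∀ {n} → (Fin n → F₂) → F₂
sum₂ {zero}  f = false
sum₂ {suc n} f = f zero xor sum₂ (λ b → f (suc b))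

_*ₘ_ : ∀ {n} → Mat n → Mat n → Mat n
(M *ₘ N) a c = sum₂ (λ b → M a b ∧ N b c)

_·ᵥ_ : ∀ {n} → Mat n → Vec₂ n → Vec₂ n
(M ·ᵥ v) a = sum₂ (λ b → M a b ∧ v b)

idM : ∀ {n} → Mat n
idM a b = ⌊ a ≟ b ⌋

_≈ₘ_ : ∀ {n} → Mat n → Mat n → Set
M ≈ₘ N = ∀ a b → M a b ≡ N a b

_≈ᵥ_ : ∀ {n} → Vec₂ n → Vec₂ n → Set
v ≈ᵥ w = ∀ a → v a ≡ w a

charVec : ∀ {n} → Fin n → Vec₂ n
charVec s a = ⌊ a ≟ s ⌋

Graph : ℕ → Set
Graph n = Fin n → Fin n → Bool

IsSimple : ∀ {n} → Graph n → Set
IsSimple {n} E = (∀ a b → E a b ≡ E b a) × (∀ a → E a a ≡ false)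
  where open import Data.Product using (_×_)

data Reachable {n} (E : Graph n) : Fin n → Fin n → Set where
  here : ∀ {u} → Reachable E u u
  step : ∀ {u w v} → E u w ≡ true → Reachable E w v → Reachable E u v

IsConnected : ∀ {n} → Graph n → Set
IsConnected E = ∀ u v → Reachable E u v

-- Vertices s₁,…,s_n are 0,…,n-1 in Fin n; with n = suc (suc m),
-- s₁,…,s_{n-1} are  inject₁ j  for  j : Fin (suc m), and s_n = fromℕ (suc m).
-- s₁,…,s_{n-1} is an induced path: s_i s_j ∈ R  iff  |i - j| = 1.
IsInducedPath : ∀ {m} → Graph (suc (suc m)) → Set
IsInducedPath {m} E = ∀ (i j : Fin (suc m)) →
  (E (inject₁ i) (inject₁ j) ≡ true → (toℕ j ≡ suc (toℕ i) ⊎ toℕ i ≡ suc (toℕ j)))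
  × ((toℕ j ≡ suc (toℕ i) ⊎ toℕ i ≡ suc (toℕ j)) → E (inject₁ i) (inject₁ j) ≡ true)
  where open import Data.Product using (_×_)

flipM : ∀ {n} → Graph n → Fin n → Mat n
flipM E s a b = ⌊ a ≟ b ⌋ ∨ (⌊ b ≟ s ⌋ ∧ E a b)

clamp : (n : ℕ) → ℕ → Fin (suc n)
clamp zero    k       = zero
clamp (suc n) zero    = zero
clamp (suc n) (suc k) = suc (clamp n k)

-- barℕ k = \overline{k+1}:  \overline1 = \tilde s₁,
-- \overline{i+1} = 𝐬_i ⋯ 𝐬_1 \overline1 = 𝐬_i \overline i
barℕ : ∀ {n} → Graph (suc n) → ℕ → Vec₂ (suc n)
barℕ {n} E zero    = charVec (clamp n 0)
barℕ {n} E (suc k) = flipM E (clamp n k) ·ᵥ barℕ E k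

-- Π = {\overline1,…,\overline n}, indexed by Fin n (index i ↦ \overline{i+1})
bar : ∀ {n} → Graph (suc n) → Fin (suc n) → Vec₂ (suc n)
bar E i = barℕ E (toℕ i)

data InWP {m} (E : Graph (suc (suc m))) : Mat (suc (suc m)) → Set where
  gen  : ∀ (j : Fin (suc m)) → InWP E (flipM E (inject₁ j))
  one  : InWP E idM
  mul  : ∀ {M N} → InWP E M → InWP E N → InWP E (M *ₘ N)
  inv  : ∀ {M N} → InWP E M → (M *ₘ N) ≈ₘ idM → (N *ₘ M) ≈ₘ idM → InWP E N
  resp : ∀ {M N} → InWP E M → M ≈ₘ N → InWP E N

WP : ∀ {m} → Graph (suc (suc m)) → Set
WP E = Σ (Mat _) (InWP E)

_·W_ : ∀ {m} {E : Graph (suc (suc m))} → WP E → WP E → WP E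
(M , p) ·W (N , q) = (M *ₘ N) , mul p q

_≈W_ : ∀ {m} {E : Graph (suc (suc m))} → WP E → WP E → Set
x ≈W y = proj₁ x ≈ₘ proj₁ y

record IsoToSym {m} (E : Graph (suc (suc m))) : Set where
  field
    φ     : WP E → Permutation′ (suc (suc m))
    φ-wd  : ∀ x y → x ≈W y → ∀ i → φ x ⟨$⟩ʳ i ≡ φ y ⟨$⟩ʳ i
    φ-hom : ∀ x y i → φ (x ·W y) ⟨$⟩ʳ i ≡ φ x ⟨$⟩ʳ (φ y ⟨$⟩ʳ i)
    φ-inj : ∀ x y → (∀ i → φ x ⟨$⟩ʳ i ≡ φ y ⟨$⟩ʳ i) → x ≈W y
    φ-surj : ∀ (σ : Permutation′ (suc (suc m))) →
             ∃ λ x → ∀ i → φ x ⟨$⟩ʳ i ≡ σ ⟨$⟩ʳ i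

module Submission where

-- Write \tilde s_0 = 0. The move 𝐬_k adds v(s_k) Σ_{t ∼ s_k} \tilde t to v, which on the path
-- s₁,…,s_{n-1} is v(s_k) (\tilde s_{k-1} + \tilde s_{k+1}); so by induction \overline{k+1} restricted
-- to the path is \tilde s_k + \tilde s_{k+1}. Hence the vectors of Π are pairwise distinct (for n = 2 they differ at s_n,
-- which connectivity makes adjacent to s₁), and 𝐬_j permutes Π as the transposition of \overline j and
-- \overline{j+1}: it sends \overline j to \overline{j+1} by definition, is an involution, and fixes every
-- vector vanishing at s_j. Thus every element of W_P permutes Π and fixes \tilde s_n, giving a homomorphism
-- W_P → S_n. It is injective because Π together with \tilde s_n spans F₂ⁿ, and surjective because
-- adjacent transpositions generate S_n.

open import Defs
open import Algebra.Bundles using (CommutativeRing)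
import Algebra.Properties.CommutativeSemigroup as CommSemigroupProps
open import Data.Bool using (true; false; _∧_; _∨_; _xor_)
open import Data.Bool.Properties
  using ( xor-∧-commutativeRing; xor-assoc; xor-same; xor-identityʳ
        ; ∧-comm; ∧-assoc; ∧-zeroʳ; ∧-identityʳ; ∧-distribˡ-xor; T-≡)
open import Data.Empty using (⊥-elim)
open import Data.Fin using (Fin; zero; suc; toℕ; inject₁; fromℕ; fromℕ<; _≟_)
import Data.Fin.Properties as Fin
open import Data.Fin.Permutation
  using (Permutation′; _⟨$⟩ʳ_; _⟨$⟩ˡ_; _∘ₚ_; id; flip; transpose; inverseˡ; inverseʳ)
open import Data.Fin.Relation.Unary.Top using (view; ‵fromℕ; ‵inj₁)
open import Data.Nat using (ℕ; zero; suc; _+_; _∸_; _≤_; _<_; s≤s)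
import Data.Nat.Properties as ℕ
open import Data.Product using (Σ; _×_; _,_; proj₁; proj₂)
open import Data.Sum using (inj₁; inj₂)
open import Function using (_∘_)
open import Function.Bundles using (mk⇔; Equivalence)
open import Relation.Binary.Definitions using (tri<; tri≈; tri>)
open import Relation.Binary.PropositionalEquality
open import Relation.Nullary using (¬_; yes; no; does; proof)
open import Relation.Nullary.Decidable
  using (⌊_⌋; _⊎-dec_; dec-true; dec-false; does-⇔; isYes≗does; ⌊⌋-map′)
open import Relation.Nullary.Reflects using (det; fromEquivalence)

open CommSemigroupProps (CommutativeRing.+-commutativeSemigroup xor-∧-commutativeRing)
  using () renaming (interchange to xor-interchange)
open CommSemigroupProps (CommutativeRing.*-commutativeSemigroup xor-∧-commutativeRing)
  using () renaming (x∙yz≈y∙xz to ∧-leftComm)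

true≢false : true ≢ false
true≢false ()

xor-cancelʳ : ∀ x y → (x xor y) xor y ≡ x
xor-cancelʳ x y = trans (xor-assoc x y y) (trans (cong (x xor_) (xor-same y)) (xor-identityʳ x))

sum₂-cong : ∀ {n} {f g : Fin n → F₂} → (∀ b → f b ≡ g b) → sum₂ f ≡ sum₂ g
sum₂-cong {zero}  f≗g = refl
sum₂-cong {suc n} f≗g = cong₂ _xor_ (f≗g zero) (sum₂-cong (λ b → f≗g (suc b)))

sum₂-false : ∀ n → sum₂ {n} (λ _ → false) ≡ false
sum₂-false zero    = refl
sum₂-false (suc n) = sum₂-false n

sum₂-xor : ∀ {n} (f g : Fin n → F₂) → sum₂ (λ b → f b xor g b) ≡ sum₂ f xor sum₂ g
sum₂-xor {zero}  f g = refl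
sum₂-xor {suc n} f g =
  trans (cong ((f zero xor g zero) xor_) (sum₂-xor (λ b → f (suc b)) (λ b → g (suc b))))
        (xor-interchange (f zero) (g zero) _ _)

∧-distribˡ-sum₂ : ∀ {n} x (f : Fin n → F₂) → x ∧ sum₂ f ≡ sum₂ (λ b → x ∧ f b)
∧-distribˡ-sum₂ {n} false f = sym (sum₂-false n)
∧-distribˡ-sum₂     true  f = refl

∧-distribʳ-sum₂ : ∀ {n} (f : Fin n → F₂) x → sum₂ f ∧ x ≡ sum₂ (λ b → f b ∧ x)
∧-distribʳ-sum₂ f x =
  trans (∧-comm _ x) (trans (∧-distribˡ-sum₂ x f) (sum₂-cong (λ b → ∧-comm x (f b))))

sum₂-comm : ∀ {n k} (h : Fin n → Fin k → F₂) →
  sum₂ (λ b → sum₂ (λ c → h b c)) ≡ sum₂ (λ c → sum₂ (λ b → h b c))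
sum₂-comm {zero}  {k} h = sym (sum₂-false k)
sum₂-comm {suc n}     h =
  trans (cong (sum₂ (h zero) xor_) (sum₂-comm (λ b → h (suc b))))
        (sym (sum₂-xor (h zero) (λ c → sum₂ (λ b → h (suc b) c))))

⌊≟⌋-sym : ∀ {n} (a b : Fin n) → ⌊ a ≟ b ⌋ ≡ ⌊ b ≟ a ⌋
⌊≟⌋-sym a b = trans (isYes≗does (a ≟ b))
  (trans (does-⇔ (mk⇔ sym sym) (a ≟ b) (b ≟ a)) (sym (isYes≗does (b ≟ a))))

⌊≟⌋-toℕ : ∀ {n} (a b : Fin n) → ⌊ a ≟ b ⌋ ≡ does (toℕ a ℕ.≟ toℕ b)
⌊≟⌋-toℕ a b = trans (isYes≗does (a ≟ b))
  (does-⇔ (mk⇔ (cong toℕ) Fin.toℕ-injective) (a ≟ b) (toℕ a ℕ.≟ toℕ b))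

⌊≟⌋-refl : ∀ {n} (a : Fin n) → ⌊ a ≟ a ⌋ ≡ true
⌊≟⌋-refl a = trans (isYes≗does (a ≟ a)) (dec-true (a ≟ a) refl)

sum₂-selectˡ : ∀ {n} (a : Fin n) (f : Fin n → F₂) → sum₂ (λ b → ⌊ a ≟ b ⌋ ∧ f b) ≡ f a
sum₂-selectˡ {suc n} zero    f = trans (cong (f zero xor_) (sum₂-false n)) (xor-identityʳ _)
sum₂-selectˡ {suc n} (suc a) f =
  trans (sum₂-cong (λ b → cong (_∧ f (suc b)) (⌊⌋-map′ _ _ (a ≟ b))))
        (sum₂-selectˡ a (λ b → f (suc b)))

sum₂-selectʳ : ∀ {n} (a : Fin n) (f : Fin n → F₂) → sum₂ (λ b → ⌊ b ≟ a ⌋ ∧ f b) ≡ f a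
sum₂-selectʳ a f = trans (sum₂-cong (λ b → cong (_∧ f b) (⌊≟⌋-sym b a))) (sum₂-selectˡ a f)

·ᵥ-congˡ : ∀ {n} {M N : Mat n} → M ≈ₘ N → ∀ v → (M ·ᵥ v) ≈ᵥ (N ·ᵥ v)
·ᵥ-congˡ M≈N v a = sum₂-cong (λ b → cong (_∧ v b) (M≈N a b))

·ᵥ-congʳ : ∀ {n} (M : Mat n) {u v : Vec₂ n} → u ≈ᵥ v → (M ·ᵥ u) ≈ᵥ (M ·ᵥ v)
·ᵥ-congʳ M u≈v a = sum₂-cong (λ b → cong (M a b ∧_) (u≈v b))

*ₘ-·ᵥ : ∀ {n} (M N : Mat n) v → ((M *ₘ N) ·ᵥ v) ≈ᵥ (M ·ᵥ (N ·ᵥ v))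
*ₘ-·ᵥ M N v a = begin
  sum₂ (λ c → sum₂ (λ b → M a b ∧ N b c) ∧ v c)
    ≡⟨ sum₂-cong (λ c → ∧-distribʳ-sum₂ (λ b → M a b ∧ N b c) (v c)) ⟩
  sum₂ (λ c → sum₂ (λ b → (M a b ∧ N b c) ∧ v c))
    ≡⟨ sum₂-comm (λ c b → (M a b ∧ N b c) ∧ v c) ⟩
  sum₂ (λ b → sum₂ (λ c → (M a b ∧ N b c) ∧ v c))
    ≡⟨ sum₂-cong (λ b → sum₂-cong (λ c → ∧-assoc (M a b) (N b c) (v c))) ⟩
  sum₂ (λ b → sum₂ (λ c → M a b ∧ (N b c ∧ v c)))
    ≡⟨ sum₂-cong (λ b → sym (∧-distribˡ-sum₂ (M a b) (λ c → N b c ∧ v c))) ⟩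
  sum₂ (λ b → M a b ∧ sum₂ (λ c → N b c ∧ v c))
    ∎
  where open ≡-Reasoning

idM-·ᵥ : ∀ {n} (v : Vec₂ n) → (idM ·ᵥ v) ≈ᵥ v
idM-·ᵥ v a = sum₂-selectˡ a v

·ᵥ-xor : ∀ {n} (M : Mat n) u v → (M ·ᵥ (λ a → u a xor v a)) ≈ᵥ (λ a → (M ·ᵥ u) a xor (M ·ᵥ v) a)
·ᵥ-xor M u v a = trans (sum₂-cong (λ b → ∧-distribˡ-xor (M a b) (u b) (v b)))
                       (sum₂-xor (λ b → M a b ∧ u b) (λ b → M a b ∧ v b))

·ᵥ-∧ : ∀ {n} (M : Mat n) x v → (M ·ᵥ (λ a → x ∧ v a)) ≈ᵥ (λ a → x ∧ (M ·ᵥ v) a)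
·ᵥ-∧ M x v a = trans (sum₂-cong (λ b → ∧-leftComm (M a b) x (v b)))
                     (sym (∧-distribˡ-sum₂ x (λ b → M a b ∧ v b)))

·ᵥ-charVec : ∀ {n} (M : Mat n) b a → (M ·ᵥ charVec b) a ≡ M a b
·ᵥ-charVec M b a = trans (sum₂-cong (λ c → ∧-comm (M a c) _)) (sum₂-selectʳ b (M a))

-- the characteristic vector of the vertex with index k (the zero vector when k ≥ n)
charVecℕ : ∀ {n} → ℕ → Vec₂ n
charVecℕ k a = does (toℕ a ℕ.≟ k)

charVec-toℕ : ∀ {n} (b : Fin n) → charVec b ≈ᵥ charVecℕ (toℕ b)
charVec-toℕ b a = ⌊≟⌋-toℕ a b

record Sends {n} (M : Mat n) (v w : Vec₂ n) : Set where
  constructor sends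
  field action : (M ·ᵥ v) ≈ᵥ w
open Sends

sends-id : ∀ {n} (v : Vec₂ n) → Sends idM v v
sends-id v = sends (idM-·ᵥ v)

sends-*ₘ : ∀ {n} {M N : Mat n} {u v w} → Sends N u v → Sends M v w → Sends (M *ₘ N) u w
sends-*ₘ {M = M} {N} {u} (sends N·u≈v) (sends M·v≈w) =
  sends λ a → trans (*ₘ-·ᵥ M N u a) (trans (·ᵥ-congʳ M N·u≈v a) (M·v≈w a))

sends-inverse : ∀ {n} {M N : Mat n} {v w} → (N *ₘ M) ≈ₘ idM → Sends M v w → Sends N w v
sends-inverse {M = M} {N} {v} {w} NM≈1 (sends M·v≈w) = sends λ a → begin
  (N ·ᵥ w) a             ≡⟨ ·ᵥ-congʳ N (λ b → sym (M·v≈w b)) a ⟩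
  (N ·ᵥ (M ·ᵥ v)) a      ≡⟨ sym (*ₘ-·ᵥ N M v a) ⟩
  ((N *ₘ M) ·ᵥ v) a      ≡⟨ ·ᵥ-congˡ NM≈1 v a ⟩
  (idM ·ᵥ v) a           ≡⟨ idM-·ᵥ v a ⟩
  v a                    ∎
  where open ≡-Reasoning

sends-respˡ : ∀ {n} {M N : Mat n} {v w} → M ≈ₘ N → Sends M v w → Sends N v w
sends-respˡ {v = v} M≈N (sends M·v≈w) = sends λ a → trans (sym (·ᵥ-congˡ M≈N v a)) (M·v≈w a)

sends-respʳ : ∀ {n} {M : Mat n} {v w w′} → w ≈ᵥ w′ → Sends M v w → Sends M v w′
sends-respʳ w≈w′ (sends M·v≈w) = sends λ a → trans (M·v≈w a) (w≈w′ a)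

Agree : ∀ {n} → Mat n → Mat n → Vec₂ n → Set
Agree M N v = (M ·ᵥ v) ≈ᵥ (N ·ᵥ v)

module Agreement {n} (M N : Mat n) where

  agree-resp : ∀ {u v} → u ≈ᵥ v → Agree M N u → Agree M N v
  agree-resp u≈v agree a =
    trans (·ᵥ-congʳ M (λ b → sym (u≈v b)) a) (trans (agree a) (·ᵥ-congʳ N u≈v a))

  agree-xor : ∀ u v → Agree M N u → Agree M N v → Agree M N (λ a → u a xor v a)
  agree-xor u v agree-u agree-v a =
    trans (·ᵥ-xor M u v a) (trans (cong₂ _xor_ (agree-u a) (agree-v a)) (sym (·ᵥ-xor N u v a)))

  agree-∧ : ∀ x v → Agree M N v → Agree M N (λ a → x ∧ v a)
  agree-∧ x v agree-v a =
    trans (·ᵥ-∧ M x v a) (trans (cong (x ∧_) (agree-v a)) (sym (·ᵥ-∧ N x v a)))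

  agree-charVec⇒≈ₘ : (∀ b → Agree M N (charVec b)) → M ≈ₘ N
  agree-charVec⇒≈ₘ agree a b =
    trans (sym (·ᵥ-charVec M b a)) (trans (agree b a) (·ᵥ-charVec N b a))

module _ {n} (E : Graph n) (loopless : ∀ a → E a a ≡ false) where

  flipM-·ᵥ : ∀ s v a → (flipM E s ·ᵥ v) a ≡ v a xor (E a s ∧ v s)
  flipM-·ᵥ s v a =
    trans (sum₂-cong entry)
      (trans (sum₂-xor (λ b → ⌊ a ≟ b ⌋ ∧ v b) (λ b → ⌊ b ≟ s ⌋ ∧ (E a b ∧ v b)))
             (cong₂ _xor_ (sum₂-selectˡ a v) (sum₂-selectʳ s (λ b → E a b ∧ v b))))
    where
    entry : ∀ b → flipM E s a b ∧ v b ≡ (⌊ a ≟ b ⌋ ∧ v b) xor (⌊ b ≟ s ⌋ ∧ (E a b ∧ v b))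
    entry b with a ≟ b
    ... | yes refl rewrite loopless a = sym (trans (cong (v a xor_) (∧-zeroʳ _)) (xor-identityʳ _))
    ... | no _ = ∧-assoc ⌊ b ≟ s ⌋ (E a b) (v b)

  flipM-fixes : ∀ s v → v s ≡ false → Sends (flipM E s) v v
  flipM-fixes s v vs≡0 = sends λ a → begin
    (flipM E s ·ᵥ v) a       ≡⟨ flipM-·ᵥ s v a ⟩
    v a xor (E a s ∧ v s)    ≡⟨ cong (λ x → v a xor (E a s ∧ x)) vs≡0 ⟩
    v a xor (E a s ∧ false)  ≡⟨ cong (v a xor_) (∧-zeroʳ _) ⟩
    v a xor false            ≡⟨ xor-identityʳ _ ⟩
    v a                      ∎
    where open ≡-Reasoning

  flipM-involutive : ∀ s v → Sends (flipM E s) (flipM E s ·ᵥ v) v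
  flipM-involutive s v = sends λ a → begin
    (flipM E s ·ᵥ (flipM E s ·ᵥ v)) a                    ≡⟨ flipM-·ᵥ s _ a ⟩
    (flipM E s ·ᵥ v) a xor (E a s ∧ (flipM E s ·ᵥ v) s)
                        ≡⟨ cong₂ (λ x y → x xor (E a s ∧ y)) (flipM-·ᵥ s v a) flip-at-s ⟩
    (v a xor (E a s ∧ v s)) xor (E a s ∧ v s)            ≡⟨ xor-cancelʳ (v a) _ ⟩
    v a                                                  ∎
    where
    open ≡-Reasoning
    flip-at-s : (flipM E s ·ᵥ v) s ≡ v s
    flip-at-s = trans (flipM-·ᵥ s v s)
      (trans (cong (λ x → v s xor (x ∧ v s)) (loopless s)) (xor-identityʳ _))

adjacent : ∀ {n} → Fin n → Permutation′ (suc n)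
adjacent j = transpose (inject₁ j) (suc j)

adjacent-inject₁ : ∀ {n} (j : Fin n) → adjacent j ⟨$⟩ʳ inject₁ j ≡ suc j
adjacent-inject₁ j rewrite dec-true (inject₁ j ≟ inject₁ j) refl = refl

adjacent-below : ∀ {n} (j : Fin n) i → toℕ i < toℕ j → adjacent j ⟨$⟩ʳ i ≡ i
adjacent-below j i i<j
  rewrite dec-false (i ≟ inject₁ j) (λ i≡j → ℕ.<⇒≢ i<j (trans (cong toℕ i≡j) (Fin.toℕ-inject₁ j)))
        | dec-false (i ≟ suc j) (λ i≡1+j → ℕ.<⇒≢ (ℕ.m<n⇒m<1+n i<j) (cong toℕ i≡1+j))
  = refl

module AdjacentGeneration {n} (P : (Fin (suc n) → Fin (suc n)) → Set)
  (P-resp : ∀ {f g} → (∀ i → f i ≡ g i) → P f → P g)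
  (P-id : P (λ i → i))
  (P-∘ : ∀ {f g} → P f → P g → P (λ i → f (g i)))
  (P-adjacent : ∀ j → P (adjacent j ⟨$⟩ʳ_))
  where

  -- the cycle q−t ↦ q−t+1 ↦ ⋯ ↦ q (a junk identity when t > q)
  cycle : ℕ → Fin (suc n) → Permutation′ (suc n)
  cycle zero    q       = id
  cycle (suc t) zero    = id
  cycle (suc t) (suc q) = cycle t (inject₁ q) ∘ₚ adjacent q

  cycle-P : ∀ t q → P (cycle t q ⟨$⟩ʳ_)
  cycle-P zero    q       = P-id
  cycle-P (suc t) zero    = P-id
  cycle-P (suc t) (suc q) = P-∘ (P-adjacent q) (cycle-P t (inject₁ q))

  cycle-start : ∀ t q i → t + toℕ i ≡ toℕ q → cycle t q ⟨$⟩ʳ i ≡ q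
  cycle-start zero    q       i i≡q   = Fin.toℕ-injective i≡q
  cycle-start (suc t) (suc q) i t+i≡q =
    trans (cong (adjacent q ⟨$⟩ʳ_)
                (cycle-start t (inject₁ q) i (trans (ℕ.suc-injective t+i≡q) (sym (Fin.toℕ-inject₁ q)))))
          (adjacent-inject₁ q)

  cycle-below : ∀ t q i → t + toℕ i < toℕ q → cycle t q ⟨$⟩ʳ i ≡ i
  cycle-below zero    q       i _ = refl
  cycle-below (suc t) (suc q) i (s≤s t+i<q) =
    trans (cong (adjacent q ⟨$⟩ʳ_)
                (cycle-below t (inject₁ q) i (subst (t + toℕ i <_) (sym (Fin.toℕ-inject₁ q)) t+i<q)))
          (adjacent-below q i (ℕ.≤-<-trans (ℕ.m≤n+m (toℕ i) t) t+i<q))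

  FixesBelow : ℕ → Permutation′ (suc n) → Set
  FixesBelow k π = ∀ i → toℕ i < k → π ⟨$⟩ʳ i ≡ i

  -- If π fixes every i < k and sends k to q, the cycle c = (k ↦ ⋯ ↦ q) also fixes every i < k,
  -- so π = c ∘ (c⁻¹ ∘ π) with c⁻¹ ∘ π fixing every i ≤ k.
  P-fixingBelow : ∀ d k → d + k ≡ suc n → ∀ π → FixesBelow k π → P (π ⟨$⟩ʳ_)
  P-fixingBelow zero    k refl π fixes = P-resp (λ i → sym (fixes i (Fin.toℕ<n i))) P-id
  P-fixingBelow (suc d) k d+k≡ π fixes =
    P-resp (λ i → inverseʳ c)
      (P-∘ (cycle-P t q) (P-fixingBelow d (suc k) (trans (ℕ.+-suc d k) d+k≡) τ τ-fixes))
    where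
    k<n : k < suc n
    k<n = s≤s (subst (k ≤_) (ℕ.suc-injective d+k≡) (ℕ.m≤n+m k d))
    K = fromℕ< k<n
    toℕ-K : toℕ K ≡ k
    toℕ-K = Fin.toℕ-fromℕ< k<n
    q = π ⟨$⟩ʳ K
    k≤q : k ≤ toℕ q
    k≤q = ℕ.≮⇒≥ λ q<k → ℕ.<⇒≢ q<k (trans (cong toℕ (q≡K q<k)) toℕ-K)
      where
      q≡K : toℕ q < k → q ≡ K
      q≡K q<k = trans (sym (inverseˡ π)) (trans (cong (π ⟨$⟩ˡ_) (fixes q q<k)) (inverseˡ π))
    t = toℕ q ∸ k
    c = cycle t q
    c-K : c ⟨$⟩ʳ K ≡ q
    c-K = cycle-start t q K (trans (cong (t +_) toℕ-K) (trans (ℕ.+-comm t k) (ℕ.m+[n∸m]≡n k≤q)))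
    c⁻¹-fixes : ∀ i → toℕ i < k → c ⟨$⟩ˡ i ≡ i
    c⁻¹-fixes i i<k = trans (cong (c ⟨$⟩ˡ_) (sym (cycle-below t q i t+i<q))) (inverseˡ c)
      where
      t+i<q : t + toℕ i < toℕ q
      t+i<q = subst (t + toℕ i <_) (trans (ℕ.+-comm t k) (ℕ.m+[n∸m]≡n k≤q)) (ℕ.+-monoʳ-< t i<k)
    τ = π ∘ₚ flip c
    τ-fixes : FixesBelow (suc k) τ
    τ-fixes i i≤k with ℕ.m<1+n⇒m<n∨m≡n i≤k
    ... | inj₁ i<k = trans (cong (c ⟨$⟩ˡ_) (fixes i i<k)) (c⁻¹-fixes i i<k)
    ... | inj₂ i≡k rewrite Fin.toℕ-injective (trans i≡k (sym toℕ-K)) =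
      trans (cong (c ⟨$⟩ˡ_) (sym c-K)) (inverseˡ c)

  P-permutation : ∀ π → P (π ⟨$⟩ʳ_)
  P-permutation π = P-fixingBelow (suc n) 0 (ℕ.+-identityʳ (suc n)) π (λ i ())

clamp-fromℕ< : ∀ {m} k (k<1+m : k < suc m) → clamp (suc m) k ≡ inject₁ (fromℕ< k<1+m)
clamp-fromℕ<         zero    _             = refl
clamp-fromℕ< {suc m} (suc k) (s≤s k<1+m) = cong suc (clamp-fromℕ< k k<1+m)

clamp-inject₁ : ∀ {m} (j : Fin (suc m)) → clamp (suc m) (toℕ j) ≡ inject₁ j
clamp-inject₁         zero    = refl
clamp-inject₁ {suc m} (suc j) = cong suc (clamp-inject₁ j)

-- the s_{j+1}-coordinate of \tilde s_k + \tilde s_{k+1}, with \tilde s_0 = 0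
pathBar : ℕ → ℕ → F₂
pathBar k j = does (j ℕ.≟ k) xor does (suc j ℕ.≟ k)

pathBar-suc : ∀ k j → pathBar k j xor (does (k ℕ.≟ suc j) ∨ does (j ℕ.≟ suc k)) ≡ pathBar (suc k) j
pathBar-suc zero          zero    = refl
pathBar-suc (suc zero)    zero    = refl
pathBar-suc (suc (suc k)) zero    = refl
pathBar-suc zero          (suc j) = sym (xor-identityʳ _)
pathBar-suc (suc k)       (suc j) = pathBar-suc k j

pathBar-diag : ∀ k → pathBar k k ≡ true
pathBar-diag zero    = refl
pathBar-diag (suc k) = pathBar-diag k

pathBar-above : ∀ k → pathBar k (suc k) ≡ false
pathBar-above zero    = refl
pathBar-above (suc k) = pathBar-above k

pathBar-below : ∀ j → pathBar (suc j) j ≡ true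
pathBar-below zero    = refl
pathBar-below (suc j) = pathBar-below j

pathBar-far : ∀ j → pathBar (suc (suc j)) j ≡ false
pathBar-far zero    = refl
pathBar-far (suc j) = pathBar-far j

pathBar-collision : ∀ {m k k′} → k < k′ → k′ ≤ suc m →
  (∀ j → j ≤ m → pathBar k j ≡ pathBar k′ j) → m ≡ 0 × k ≡ 0 × k′ ≡ 1
pathBar-collision {m} {k} {k′} k<k′ k′≤1+m agree with k′ ℕ.≟ suc k
... | no k′≢1+k = ⊥-elim (true≢false (begin
  true                                         ≡˘⟨ pathBar-diag k ⟩
  pathBar k k                                  ≡⟨ agree k (ℕ.≤-pred (ℕ.≤-trans k<k′ k′≤1+m)) ⟩
  does (k ℕ.≟ k′) xor does (suc k ℕ.≟ k′)     ≡⟨ cong₂ _xor_ (dec-false (k ℕ.≟ k′) (ℕ.<⇒≢ k<k′))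
                                                              (dec-false (suc k ℕ.≟ k′) (k′≢1+k ∘ sym)) ⟩
  false                                        ∎))
  where open ≡-Reasoning
... | yes refl with suc k ℕ.≤? m
...   | yes 1+k≤m = ⊥-elim (true≢false (trans (sym (pathBar-diag (suc k)))
                                             (trans (sym (agree (suc k) 1+k≤m)) (pathBar-above k))))
...   | no 1+k≰m with ℕ.≤-antisym (ℕ.≤-pred k′≤1+m) (ℕ.≮⇒≥ 1+k≰m)
...     | refl = k≡0 k agree , k≡0 k agree , cong suc (k≡0 k agree)
  where
  k≡0 : ∀ k → (∀ j → j ≤ k → pathBar k j ≡ pathBar (suc k) j) → k ≡ 0
  k≡0 zero    _     = refl
  k≡0 (suc j) agree = ⊥-elim (true≢false (trans (sym (pathBar-below j))
                                                (trans (agree j (ℕ.n≤1+n j)) (pathBar-far j))))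

two-vertices-adjacent : ∀ (E : Graph 2) → (∀ a → E a a ≡ false) → IsConnected E →
  E (suc zero) zero ≡ true
two-vertices-adjacent E loopless connected with connected (suc zero) zero
... | step {w = zero}     1~0 _ = 1~0
... | step {w = suc zero} 1~1 _ = ⊥-elim (true≢false (trans (sym 1~1) (loopless (suc zero))))

module PathGraph (m : ℕ) (E : Graph (suc (suc m))) (loopless : ∀ a → E a a ≡ false)
                 (connected : IsConnected E) (path : IsInducedPath E) where

  last : Fin (suc (suc m))
  last = fromℕ (suc m)

  last-off-path : ∀ (j : Fin (suc m)) → charVec last (inject₁ j) ≡ false
  last-off-path j =
    trans (isYes≗does (inject₁ j ≟ last)) (dec-false (inject₁ j ≟ last) (Fin.fromℕ≢inject₁ ∘ sym))

  path-adjacency : ∀ (i j : Fin (suc m)) →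
    E (inject₁ i) (inject₁ j) ≡ does (toℕ j ℕ.≟ suc (toℕ i)) ∨ does (toℕ i ℕ.≟ suc (toℕ j))
  path-adjacency i j =
    det (fromEquivalence (proj₁ (path i j) ∘ Equivalence.to T-≡) (Equivalence.from T-≡ ∘ proj₂ (path i j)))
        (proof ((toℕ j ℕ.≟ suc (toℕ i)) ⊎-dec (toℕ i ℕ.≟ suc (toℕ j))))

  barℕ-on-path : ∀ k → k ≤ suc m → ∀ (j : Fin (suc m)) → barℕ E k (inject₁ j) ≡ pathBar k (toℕ j)
  barℕ-on-path zero    _     zero    = refl
  barℕ-on-path zero    _     (suc j) = refl
  barℕ-on-path (suc k) k<1+m j       = begin
    barℕ E (suc k) (inject₁ j)
      ≡⟨ cong (λ s → (flipM E s ·ᵥ barℕ E k) (inject₁ j)) (clamp-fromℕ< k k<1+m) ⟩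
    (flipM E (inject₁ c) ·ᵥ barℕ E k) (inject₁ j)
      ≡⟨ flipM-·ᵥ E loopless (inject₁ c) (barℕ E k) (inject₁ j) ⟩
    barℕ E k (inject₁ j) xor (E (inject₁ j) (inject₁ c) ∧ barℕ E k (inject₁ c))
      ≡⟨ cong₂ (λ x y → x xor (E (inject₁ j) (inject₁ c) ∧ y))
               (IH j) (trans (IH c) (trans (cong (pathBar k) toℕ-c) (pathBar-diag k))) ⟩
    pathBar k (toℕ j) xor (E (inject₁ j) (inject₁ c) ∧ true)
      ≡⟨ cong (pathBar k (toℕ j) xor_) (trans (∧-identityʳ _) (path-adjacency j c)) ⟩
    pathBar k (toℕ j) xor (does (toℕ c ℕ.≟ suc (toℕ j)) ∨ does (toℕ j ℕ.≟ suc (toℕ c)))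
      ≡⟨ cong (λ x → pathBar k (toℕ j) xor (does (x ℕ.≟ suc (toℕ j)) ∨ does (toℕ j ℕ.≟ suc x)))
              toℕ-c ⟩
    pathBar k (toℕ j) xor (does (k ℕ.≟ suc (toℕ j)) ∨ does (toℕ j ℕ.≟ suc k))
      ≡⟨ pathBar-suc k (toℕ j) ⟩
    pathBar (suc k) (toℕ j) ∎
    where
    open ≡-Reasoning
    c = fromℕ< k<1+m
    toℕ-c : toℕ c ≡ k
    toℕ-c = Fin.toℕ-fromℕ< k<1+m
    IH = barℕ-on-path k (ℕ.<⇒≤ k<1+m)

  bar-on-path : ∀ i (j : Fin (suc m)) → bar E i (inject₁ j) ≡ pathBar (toℕ i) (toℕ j)
  bar-on-path i = barℕ-on-path (toℕ i) (Fin.toℕ≤pred[n] i)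

  bar-suc : ∀ (j : Fin (suc m)) → bar E (suc j) ≡ flipM E (inject₁ j) ·ᵥ bar E (inject₁ j)
  bar-suc j = cong₂ (λ s k → flipM E s ·ᵥ barℕ E k) (clamp-inject₁ j) (sym (Fin.toℕ-inject₁ j))

  last-adjacent-first : m ≡ 0 → E last zero ≡ true
  last-adjacent-first m≡0 = subst
    (λ m → (E : Graph (suc (suc m))) → (∀ a → E a a ≡ false) → IsConnected E →
           E (fromℕ (suc m)) zero ≡ true)
    (sym m≡0) two-vertices-adjacent E loopless connected

  barℕ-distinct : ∀ {k k′} → k < k′ → k′ ≤ suc m → ¬ barℕ E k ≈ᵥ barℕ E k′
  barℕ-distinct {k} {k′} k<k′ k′≤1+m same with pathBar-collision k<k′ k′≤1+m agree-on-path
    where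
    agree-on-path : ∀ j → j ≤ m → pathBar k j ≡ pathBar k′ j
    agree-on-path j j≤m = subst (λ x → pathBar k x ≡ pathBar k′ x) (Fin.toℕ-fromℕ< (s≤s j≤m))
      (trans (sym (barℕ-on-path k (ℕ.<⇒≤ (ℕ.<-≤-trans k<k′ k′≤1+m)) c))
             (trans (same (inject₁ c)) (barℕ-on-path k′ k′≤1+m c)))
      where c = fromℕ< (s≤s j≤m)
  ... | m≡0 , refl , refl =
    true≢false (sym (trans (same last) (trans bar₁-last (last-adjacent-first m≡0))))
    where
    bar₁-last : barℕ E 1 last ≡ E last zero
    bar₁-last = trans (flipM-·ᵥ E loopless zero (charVec zero) last) (∧-identityʳ _)

  bar-injective : ∀ i i′ → bar E i ≈ᵥ bar E i′ → i ≡ i′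
  bar-injective i i′ same with Fin.<-cmp i i′
  ... | tri< i<i′ _ _ = ⊥-elim (barℕ-distinct i<i′ (Fin.toℕ≤pred[n] i′) same)
  ... | tri≈ _ i≡i′ _ = i≡i′
  ... | tri> _ _ i′<i = ⊥-elim (barℕ-distinct i′<i (Fin.toℕ≤pred[n] i) (λ a → sym (same a)))

  bar-off-path : ∀ (j : Fin (suc m)) i → i ≢ inject₁ j → i ≢ suc j → bar E i (inject₁ j) ≡ false
  bar-off-path j i i≢j i≢1+j = trans (bar-on-path i j) (cong₂ _xor_
    (dec-false (toℕ j ℕ.≟ toℕ i)
               (λ j≡i → i≢j (Fin.toℕ-injective (trans (sym j≡i) (sym (Fin.toℕ-inject₁ j))))))
    (dec-false (suc (toℕ j) ℕ.≟ toℕ i) (λ 1+j≡i → i≢1+j (Fin.toℕ-injective (sym 1+j≡i)))))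

  flip-sends-bar : ∀ (j : Fin (suc m)) i →
    Sends (flipM E (inject₁ j)) (bar E i) (bar E (adjacent j ⟨$⟩ʳ i))
  flip-sends-bar j i with i ≟ inject₁ j
  ... | yes refl = sends (cong-app (sym (bar-suc j)))
  ... | no i≢j with i ≟ suc j
  ...   | yes refl = subst (λ v → Sends (flipM E (inject₁ j)) v (bar E (inject₁ j)))
                           (sym (bar-suc j)) (flipM-involutive E loopless (inject₁ j) (bar E (inject₁ j)))
  ...   | no i≢1+j = flipM-fixes E loopless (inject₁ j) (bar E i) (bar-off-path j i i≢j i≢1+j)

  record PermutesΠ (M : Mat (suc (suc m))) : Set where
    field
      perm       : Permutation′ (suc (suc m))
      sends-bar  : ∀ i → Sends M (bar E i) (bar E (perm ⟨$⟩ʳ i))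
      fixes-last : Sends M (charVec last) (charVec last)
  open PermutesΠ

  permutesΠ : ∀ {M} → InWP E M → PermutesΠ M
  permutesΠ (gen j) = record
    { perm       = adjacent j
    ; sends-bar  = flip-sends-bar j
    ; fixes-last = flipM-fixes E loopless (inject₁ j) (charVec last) (last-off-path j) }
  permutesΠ one = record
    { perm       = id
    ; sends-bar  = λ i → sends-id (bar E i)
    ; fixes-last = sends-id (charVec last) }
  permutesΠ (mul p q) = record
    { perm       = perm Q ∘ₚ perm P
    ; sends-bar  = λ i → sends-*ₘ (sends-bar Q i) (sends-bar P (perm Q ⟨$⟩ʳ i))
    ; fixes-last = sends-*ₘ (fixes-last Q) (fixes-last P) }
    where P = permutesΠ p
          Q = permutesΠ q
  permutesΠ (inv p _ NM≈1) = record
    { perm       = flip (perm P)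
    ; sends-bar  = λ i → sends-inverse NM≈1
        (sends-respʳ (cong-app (cong (bar E) (inverseʳ (perm P)))) (sends-bar P (perm P ⟨$⟩ˡ i)))
    ; fixes-last = sends-inverse NM≈1 (fixes-last P) }
    where P = permutesΠ p
  permutesΠ (resp p M≈N) = record
    { perm       = perm P
    ; sends-bar  = λ i → sends-respˡ M≈N (sends-bar P i)
    ; fixes-last = sends-respˡ M≈N (fixes-last P) }
    where P = permutesΠ p

  charVecℕ-last : ∀ {l} → l ≤ m → charVecℕ l last ≡ false
  charVecℕ-last {l} l≤m =
    dec-false (toℕ last ℕ.≟ l)
              (λ last≡l → ℕ.<⇒≢ (s≤s l≤m) (trans (sym last≡l) (Fin.toℕ-fromℕ (suc m))))

  charVecℕ-step : ∀ k → suc k ≤ m →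
    (λ a → (barℕ E (suc k) a xor charVecℕ k a) xor (barℕ E (suc k) last ∧ charVec last a))
      ≈ᵥ charVecℕ (suc k)
  charVecℕ-step k 1+k≤m a with view a
  ... | ‵inj₁ {i = j} _ = begin
    (barℕ E (suc k) (inject₁ j) xor charVecℕ k (inject₁ j)) xor (β ∧ charVec last (inject₁ j))
      ≡⟨ cong₂ (λ x y → (x xor charVecℕ k (inject₁ j)) xor (β ∧ y))
               (barℕ-on-path (suc k) (ℕ.m≤n⇒m≤1+n 1+k≤m) j) (last-off-path j) ⟩
    (pathBar (suc k) (toℕ j) xor charVecℕ k (inject₁ j)) xor (β ∧ false)
      ≡⟨ cong₂ (λ x y → (pathBar (suc k) (toℕ j) xor does (x ℕ.≟ k)) xor y)
               (Fin.toℕ-inject₁ j) (∧-zeroʳ β) ⟩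
    (pathBar (suc k) (toℕ j) xor does (toℕ j ℕ.≟ k)) xor false
      ≡⟨ trans (xor-identityʳ _) (xor-cancelʳ _ _) ⟩
    does (toℕ j ℕ.≟ suc k)
      ≡⟨ cong (λ x → does (x ℕ.≟ suc k)) (sym (Fin.toℕ-inject₁ j)) ⟩
    charVecℕ (suc k) (inject₁ j) ∎
    where
    open ≡-Reasoning
    β = barℕ E (suc k) last
  ... | ‵fromℕ = begin
    (β xor charVecℕ k last) xor (β ∧ charVec last last)
      ≡⟨ cong₂ (λ x y → (β xor x) xor (β ∧ y)) (charVecℕ-last (ℕ.<⇒≤ 1+k≤m)) (⌊≟⌋-refl last) ⟩
    (β xor false) xor (β ∧ true)
      ≡⟨ cong₂ _xor_ (xor-identityʳ β) (∧-identityʳ β) ⟩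
    β xor β
      ≡⟨ xor-same β ⟩
    false
      ≡⟨ sym (charVecℕ-last 1+k≤m) ⟩
    charVecℕ (suc k) last ∎
    where
    open ≡-Reasoning
    β = barℕ E (suc k) last

  module _ (M N : Mat (suc (suc m)))
           (agree-last : Agree M N (charVec last)) (agree-bar : ∀ i → Agree M N (bar E i)) where
    open Agreement M N

    agree-barℕ : ∀ k → k ≤ suc m → Agree M N (barℕ E k)
    agree-barℕ k k≤1+m =
      subst (λ k → Agree M N (barℕ E k)) (Fin.toℕ-fromℕ< (s≤s k≤1+m)) (agree-bar (fromℕ< (s≤s k≤1+m)))

    agree-charVecℕ : ∀ k → k ≤ m → Agree M N (charVecℕ k)
    agree-charVecℕ zero    _     = agree-resp (charVec-toℕ zero) (agree-bar zero)
    agree-charVecℕ (suc k) 1+k≤m = agree-resp (charVecℕ-step k 1+k≤m)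
      (agree-xor (λ a → barℕ E (suc k) a xor charVecℕ k a) (λ a → barℕ E (suc k) last ∧ charVec last a)
        (agree-xor (barℕ E (suc k)) (charVecℕ k)
          (agree-barℕ (suc k) (ℕ.m≤n⇒m≤1+n 1+k≤m)) (agree-charVecℕ k (ℕ.<⇒≤ 1+k≤m)))
        (agree-∧ (barℕ E (suc k) last) (charVec last) agree-last))

    agree-on-Π⇒≈ₘ : M ≈ₘ N
    agree-on-Π⇒≈ₘ = agree-charVec⇒≈ₘ agree-vertex
      where
      agree-vertex : ∀ b → Agree M N (charVec b)
      agree-vertex b with view b
      ... | ‵fromℕ          = agree-last
      ... | ‵inj₁ {i = j} _ = agree-resp
        (λ a → trans (cong (λ x → does (toℕ a ℕ.≟ x)) (sym (Fin.toℕ-inject₁ j)))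
                     (sym (charVec-toℕ (inject₁ j) a)))
        (agree-charVecℕ (toℕ j) (Fin.toℕ≤pred[n] j))

  Realizes : (Fin (suc (suc m)) → Fin (suc (suc m))) → Set
  Realizes f = Σ (WP E) λ x → ∀ i → Sends (proj₁ x) (bar E i) (bar E (f i))

  realizes-permutation : ∀ π → Realizes (π ⟨$⟩ʳ_)
  realizes-permutation = P-permutation
    where
    open AdjacentGeneration Realizes
      (λ f≗g (x , x-sends) → x , λ i → sends-respʳ (cong-app (cong (bar E) (f≗g i))) (x-sends i))
      ((idM , one) , λ i → sends-id (bar E i))
      (λ ((M , p) , M-sends) ((N , q) , N-sends) →
         (M *ₘ N , mul p q) , λ i → sends-*ₘ (N-sends i) (M-sends _))
      (λ j → (flipM E (inject₁ j) , gen j) , flip-sends-bar j)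

  φ : WP E → Permutation′ (suc (suc m))
  φ (M , p) = perm (permutesΠ p)

  φ-unique : ∀ (x : WP E) (f : Fin (suc (suc m)) → Fin (suc (suc m))) →
    (∀ i → Sends (proj₁ x) (bar E i) (bar E (f i))) → ∀ i → φ x ⟨$⟩ʳ i ≡ f i
  φ-unique (M , p) f x-sends i =
    bar-injective (φ (M , p) ⟨$⟩ʳ i) (f i)
      (λ a → trans (sym (action (sends-bar (permutesΠ p) i) a)) (action (x-sends i) a))

  φ-respects : ∀ (x y : WP E) → x ≈W y → ∀ i → φ x ⟨$⟩ʳ i ≡ φ y ⟨$⟩ʳ i
  φ-respects x (N , q) x≈y = φ-unique x (φ (N , q) ⟨$⟩ʳ_)
    (λ i → sends-respˡ (λ a b → sym (x≈y a b)) (sends-bar (permutesΠ q) i))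

  φ-injective : ∀ (x y : WP E) → (∀ i → φ x ⟨$⟩ʳ i ≡ φ y ⟨$⟩ʳ i) → x ≈W y
  φ-injective (M , p) (N , q) φx≗φy = agree-on-Π⇒≈ₘ M N
    (λ a → trans (action (fixes-last P) a) (sym (action (fixes-last Q) a)))
    (λ i a → trans (action (sends-bar P i) a)
               (trans (cong-app (cong (bar E) (φx≗φy i)) a) (sym (action (sends-bar Q i) a))))
    where P = permutesΠ p
          Q = permutesΠ q

  isoToSym : IsoToSym E
  isoToSym = record
    { φ      = φ
    ; φ-wd   = φ-respects
    ; φ-hom  = λ _ _ _ → refl
    ; φ-inj  = φ-injective
    ; φ-surj = λ σ → let (x , x-sends) = realizes-permutation σ in x , φ-unique x (σ ⟨$⟩ʳ_) x-sends
    }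

corollary3p8 : (m : ℕ) (E : Graph (suc (suc m))) →
    IsSimple E → IsConnected E → IsInducedPath E →
    ((i j : Fin (suc (suc m))) → bar E i ≈ᵥ bar E j → i ≡ j) × IsoToSym E
corollary3p8 m E (_ , loopless) connected path = bar-injective , isoToSym
  where open PathGraph m E loopless connected path
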